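{- Let $Q$ be a quiver with large weights and $i$ a vertex of $Q$ such that: (A) $i$ is an ascent in every cyclic 3-vertex full subquiver of $Q$ containing $i$; (B) $i$ is not a sink or source of $Q$; (C) $i$ is not the apex of a vortex in $Q$. Then $i$ is an exit of $Q$.
   Context: Quivers are finite directed multigraphs without loops or oriented 2-cycles, labeled, encoded by skew-symmetric $B(Q)=(b_{ij})$; mutation at $k$: $b'_{ij}=-b_{ij}$ if $k\in\{i,j\}$, else $b'_{ij}=b_{ij}+\tfrac12(|b_{ik}|b_{kj}+b_{ik}|b_{kj}|)$; $\mu[i_\ell\cdots i_1]$ means mutate at $i_1$ first, then $i_2$, ..., then $i_\ell$. Large weights: $|b_{uv}|\ge 2$ for all $u\ne v$. Write $u\dashrightarrow v$ if $b_{uv}\ge 0$. A vertex is a sink (source) if $v\dashrightarrow i$ ($i\dashrightarrow v$) for all other $v$. Full subquiver = induced subgraph. A 3-vertex quiver is cyclic if it contains an oriented 3-cycle. In a 3-vertex quiver on $\{i,j,k\}$, $i$ is an ascent (descent) if $|b_{jk}(\mu[i](Q))|>|b_{jk}(Q)|$ (resp. $<$). A vortex is a 4-vertex quiver with all weights nonzero, one vertex (its apex) a sink or source, and the other three supporting a cyclic 3-vertex subquiver; a vortex in $Q$ is a full 4-vertex subquiver that is a vortex. A vertex $i$ of $Q$ is an exit if for every sequence $i\ne i_1\ne i_2\ne\cdots\ne i_\ell$ ($\ell\ge 0$) we have $Q\ne\mu[i_\ell\cdots i_1 i](Q)$. -}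

module Defs where

open import Data.Nat using (ℕ)
open import Data.Integer using (ℤ; +_; -_; _+_; _*_; _≤_; _<_; ∣_∣; 0ℤ)
open import Data.Fin using (Fin; _≟_)
open import Data.List using (List; []; _∷_; foldl)
open import Data.Product using (_×_; Σ-syntax; ∃-syntax)
open import Data.Sum using (_⊎_)
open import Relation.Nullary using (¬_; yes; no)
open import Relation.Binary.PropositionalEquality using (_≡_; _≢_)
import Data.Nat as ℕ
open import Data.Integer using (_<?_)

-- A quiver on the labelled vertex set Fin n, encoded by its exchange matrix.
-- (No loops / no oriented 2-cycles is exactly skew-symmetry of an integer matrix.)
Matrix : ℕ → Set
Matrix n = Fin n → Fin n → ℤ

record Quiver (n : ℕ) : Set where
  constructor quiver
  field
    B     : Matrix n
    skew  : ∀ i j → B i j ≡ - B j i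

open Quiver public

-- ½(|a| b + a |b|), computed exactly: equals a*b if a>0 and b>0,
-- -(|a||b|) if a<0 and b<0, and 0 otherwise.
halfTerm : ℤ → ℤ → ℤ
halfTerm a b with 0ℤ <? a | 0ℤ <? b
... | yes _ | yes _ = a * b
... | _     | _     with a <? 0ℤ | b <? 0ℤ
...   | yes _ | yes _ = - (a * b)
...   | _     | _     = 0ℤ

mutB : ∀ {n} → Fin n → Matrix n → Matrix n
mutB k b i j with i ≟ k | j ≟ k
... | yes _ | _     = - b i j
... | no _  | yes _ = - b i j
... | no _  | no _  = b i j + halfTerm (b i k) (b k j)

-- μ[i_ℓ ⋯ i_1]: mutate at i_1 first (the head of the list is mutated first).
mutSeq : ∀ {n} → List (Fin n) → Matrix n → Matrix n
mutSeq ks b = foldl (λ c k → mutB k c) b ks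

data Chain {n : ℕ} : List (Fin n) → Set where
  []  : Chain []
  [_] : ∀ x → Chain (x ∷ [])
  _∷_ : ∀ {x y xs} → x ≢ y → Chain (y ∷ xs) → Chain (x ∷ y ∷ xs)

_≈Q_ : ∀ {n} → Matrix n → Matrix n → Set
b ≈Q c = ∀ i j → b i j ≡ c i j

LargeWeights : ∀ {n} → Quiver n → Set
LargeWeights Q = ∀ u v → u ≢ v → 2 ℕ.≤ ∣ B Q u v ∣

_⇢⟨_⟩_ : ∀ {n} → Fin n → Matrix n → Fin n → Set
u ⇢⟨ b ⟩ v = 0ℤ ≤ b u v

Cyclic3 : ∀ {n} → Matrix n → Fin n → Fin n → Fin n → Set
Cyclic3 b i j k = (0ℤ < b i j × 0ℤ < b j k × 0ℤ < b k i)
                ⊎ (0ℤ < b j i × 0ℤ < b k j × 0ℤ < b i k)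

-- in the full subquiver on {i,j,k}, i is an ascent:
-- |b_jk(μ_i)| > |b_jk|  (mutation at i of the full subquiver agrees with
-- the restriction of mutation of the whole quiver)
Ascent : ∀ {n} → Matrix n → Fin n → Fin n → Fin n → Set
Ascent b i j k = ∣ b j k ∣ ℕ.< ∣ mutB i b j k ∣

IsSink : ∀ {n} → Matrix n → Fin n → Set
IsSink b v = ∀ i → i ≢ v → i ⇢⟨ b ⟩ v

IsSource : ∀ {n} → Matrix n → Fin n → Set
IsSource b v = ∀ i → i ≢ v → v ⇢⟨ b ⟩ i

VortexApex : ∀ {n} → Matrix n → Fin n → Fin n → Fin n → Fin n → Set
VortexApex b a j k l =
  (a ≢ j × a ≢ k × a ≢ l × j ≢ k × j ≢ l × k ≢ l)
  × (b a j ≢ 0ℤ × b a k ≢ 0ℤ × b a l ≢ 0ℤ × b j k ≢ 0ℤ × b j l ≢ 0ℤ × b k l ≢ 0ℤ)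
  × ((j ⇢⟨ b ⟩ a × k ⇢⟨ b ⟩ a × l ⇢⟨ b ⟩ a) ⊎ (a ⇢⟨ b ⟩ j × a ⇢⟨ b ⟩ k × a ⇢⟨ b ⟩ l))
  × Cyclic3 b j k l

IsApexOfVortex : ∀ {n} → Matrix n → Fin n → Set
IsApexOfVortex b a = ∃[ j ] ∃[ k ] ∃[ l ] VortexApex b a j k l

IsExit : ∀ {n} → Quiver n → Fin n → Set
IsExit {n} Q i = ∀ (ks : List (Fin n)) → Chain (i ∷ ks) → ¬ (B Q ≈Q mutSeq (i ∷ ks) (B Q))

-- Mutating at i strictly raises the weight of some path w → i → v: one exists
-- because i is neither a sink nor a source, and when v → w closes a 3-cycle
-- the increase is the ascent hypothesis.  Moreover μ_i(Q) is a fork at i: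
-- every path u → i → v is closed by arrows v → u outweighing both of its
-- arrows, and neither the in- nor the out-neighbourhood of i carries an
-- oriented 3-cycle (in Q that would be a vortex with apex i).  In a fork at r
-- every oriented 3-cycle passes through r, so k ≠ r is an ascent on every
-- 3-cycle through k; mutating at k then weakly increases all weights and
-- yields a fork at k.  Along i ≠ i₁ ≠ ⋯ the raised weight therefore never
-- returns to its value in Q.

module Submission where

open import Defs
open import Data.Nat using (ℕ; suc; s≤s; z≤n)
import Data.Nat as ℕ
import Data.Nat.Properties as ℕₚ
open import Data.Integer using (ℤ; +_; -[1+_]; 0ℤ; -_; _+_; _*_; _≤_; _<_; ∣_∣; +≤+; +<+; -≤+; _≤?_; _<?_; nonNegative)
open import Data.Integer.Properties hiding (_≟_)
open import Data.Integer.Tactic.RingSolver using (solve-∀)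
open import Data.Fin using (Fin; _≟_)
open import Data.Fin.Properties using (¬∀⟶∃¬)
open import Data.List using ([]; _∷_)
open import Data.Product using (_×_; _,_; proj₁; proj₂; ∃-syntax)
open import Data.Sum using (_⊎_; inj₁; inj₂)
open import Data.Empty using (⊥-elim)
open import Relation.Nullary using (¬_; yes; no)
open import Relation.Nullary.Decidable using (¬?; _→-dec_; toSum)
open import Relation.Binary.Definitions using (tri<; tri≈; tri>)
open import Relation.Binary.PropositionalEquality

private
  variable
    n : ℕ
    u v x y z k r : Fin n

x≡-x⇒x≡0 : ∀ {x} → x ≡ - x → x ≡ 0ℤ
x≡-x⇒x≡0 {+ 0} _ = refl

+2≤⇒0< : ∀ {x} → + 2 ≤ x → 0ℤ < x
+2≤⇒0< = <-≤-trans (+<+ (s≤s z≤n))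

0<⇒+2≤ : ∀ {x} → 0ℤ < x → 2 ℕ.≤ ∣ x ∣ → + 2 ≤ x
0<⇒+2≤ {+ _} _ = +≤+

0<* : ∀ {x y} → 0ℤ < x → 0ℤ < y → 0ℤ < x * y
0<* {+ suc _} {+ suc _} _ _ = +<+ (s≤s z≤n)
0<* {+ 0} (+<+ ())
0<* {+ suc _} {+ 0} _ (+<+ ())

-i≤+∣i∣ : ∀ i → - i ≤ + ∣ i ∣
-i≤+∣i∣ (+ 0)     = ≤-refl
-i≤+∣i∣ (+ suc _) = -≤+
-i≤+∣i∣ -[1+ _ ]  = ≤-refl

0≤⇒∣∣-mono-< : ∀ {x y} → 0ℤ ≤ x → x < y → ∣ x ∣ ℕ.< ∣ y ∣
0≤⇒∣∣-mono-< (+≤+ _) (+<+ x<y) = x<y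

y+y≤x*y : ∀ {x y} → + 2 ≤ x → 0ℤ ≤ y → y + y ≤ x * y
y+y≤x*y {x} {y} 2≤x 0≤y = begin
  y + y  ≡⟨ double y ⟩
  + 2 * y ≤⟨ *-monoʳ-≤-nonNeg y 2≤x ⟩
  x * y  ∎
  where
  open ≤-Reasoning
  instance _ = nonNegative 0≤y
  double : ∀ y → y + y ≡ + 2 * y
  double = solve-∀

x+x<y+y⇒x<y : ∀ {x y} → x + x < y + y → x < y
x+x<y+y⇒x<y {x} {y} lt with <-cmp x y
... | tri< x<y _ _ = x<y
... | tri≈ _ refl _ = ⊥-elim (<-irrefl refl lt)
... | tri> _ _ y<x = ⊥-elim (<-asym lt (+-mono-< y<x y<x))

∣z∣<∣z+p∣ : ∀ {z p} → 0ℤ < z → 0ℤ < p → ∣ z ∣ ℕ.< ∣ z + p ∣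
∣z∣<∣z+p∣ {z} {p} 0<z 0<p =
  0≤⇒∣∣-mono-< (<⇒≤ 0<z) (subst (_< z + p) (+-identityʳ z) (+-monoʳ-< z 0<p))

∣z∣<∣z+p∣⇒-z<z+p : ∀ {z p} → 0ℤ ≤ p → ∣ z ∣ ℕ.< ∣ z + p ∣ → - z < z + p
∣z∣<∣z+p∣⇒-z<z+p {z} {p} 0≤p asc with +∣i∣≡i⊎+∣i∣≡-i (z + p)
... | inj₁ eq = begin-strict
  - z           ≤⟨ -i≤+∣i∣ z ⟩
  + ∣ z ∣       <⟨ +<+ asc ⟩
  + ∣ z + p ∣   ≡⟨ eq ⟩
  z + p         ∎
  where open ≤-Reasoning
... | inj₂ eq = ⊥-elim (<⇒≱ (+<+ asc) (begin
  + ∣ z + p ∣   ≡⟨ eq ⟩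
  - (z + p)     ≡⟨ neg-distrib-+ z p ⟩
  - z + - p     ≤⟨ +-monoʳ-≤ (- z) (neg-mono-≤ 0≤p) ⟩
  - z + 0ℤ      ≡⟨ +-identityʳ (- z) ⟩
  - z           ≤⟨ -i≤+∣i∣ z ⟩
  + ∣ z ∣       ∎))
  where open ≤-Reasoning

ascent⇒factors< : ∀ {x y z s} → + 2 ≤ x → + 2 ≤ y → s ≡ z + y * x → ∣ z ∣ ℕ.< ∣ s ∣
                → x < s × y < s
ascent⇒factors< {x} {y} {z} 2≤x 2≤y refl asc =
  half< (y+y≤x*y 2≤y 0≤x) , half< (subst (y + y ≤_) (*-comm x y) (y+y≤x*y 2≤x 0≤y))
  where
  open ≤-Reasoning
  0≤x = <⇒≤ (+2≤⇒0< 2≤x)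
  0≤y = <⇒≤ (+2≤⇒0< 2≤y)
  s = z + y * x
  cancel : ∀ z p → p ≡ - z + (z + p)
  cancel = solve-∀
  half< : ∀ {m} → m + m ≤ y * x → m < s
  half< {m} le = x+x<y+y⇒x<y (begin-strict
    m + m     ≤⟨ le ⟩
    y * x     ≡⟨ cancel z (y * x) ⟩
    - z + s   <⟨ +-monoˡ-< s (∣z∣<∣z+p∣⇒-z<z+p {z} (<⇒≤ (0<* (+2≤⇒0< 2≤y) (+2≤⇒0< 2≤x))) asc) ⟩
    s + s     ∎)

-- On a 3-cycle u → k → v → u: z = b u v, w = b v u, s = b u v after mutating at k.
cycle-ascent : ∀ {w x y z s} → 0ℤ < w → w < y → + 2 ≤ x → z ≡ - w → s ≡ z + x * y
             → ∣ z ∣ ℕ.< ∣ s ∣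
cycle-ascent {w} {x} {y} 0<w w<y 2≤x refl refl =
  subst (ℕ._< ∣ - w + x * y ∣) (sym (∣-i∣≡∣i∣ w)) (0≤⇒∣∣-mono-< (<⇒≤ 0<w) (begin-strict
    w               ≡⟨ cancel w ⟩
    - w + (w + w)   <⟨ +-monoʳ-< (- w) (+-mono-< w<y w<y) ⟩
    - w + (y + y)   ≤⟨ +-monoʳ-≤ (- w) (y+y≤x*y 2≤x (<⇒≤ (<-trans 0<w w<y))) ⟩
    - w + x * y     ∎))
  where
  open ≤-Reasoning
  cancel : ∀ w → w ≡ - w + (w + w)
  cancel = solve-∀

halfTerm-++ : ∀ {a c} → 0ℤ < a → 0ℤ < c → halfTerm a c ≡ a * c
halfTerm-++ {a} {c} 0<a 0<c with 0ℤ <? a | 0ℤ <? c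
... | yes _ | yes _ = refl
... | no a≯0 | _ = ⊥-elim (a≯0 0<a)
... | yes _ | no c≯0 = ⊥-elim (c≯0 0<c)

halfTerm-+- : ∀ {a c} → 0ℤ < a → c < 0ℤ → halfTerm a c ≡ 0ℤ
halfTerm-+- {a} {c} 0<a c<0 with 0ℤ <? a | 0ℤ <? c
... | yes _ | yes 0<c = ⊥-elim (<-asym 0<c c<0)
... | no a≯0 | _ = ⊥-elim (a≯0 0<a)
... | yes _ | no _ with a <? 0ℤ | c <? 0ℤ
...   | yes a<0 | _ = ⊥-elim (<-asym a<0 0<a)
...   | no _ | _ = refl

halfTerm--+ : ∀ {a c} → a < 0ℤ → 0ℤ < c → halfTerm a c ≡ 0ℤ
halfTerm--+ {a} {c} a<0 0<c with 0ℤ <? a | 0ℤ <? c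
... | yes 0<a | _ = ⊥-elim (<-asym 0<a a<0)
... | no _ | _ with a <? 0ℤ | c <? 0ℤ
...   | _ | yes c<0 = ⊥-elim (<-asym c<0 0<c)
...   | yes _ | no _ = refl
...   | no _ | no _ = refl

halfTerm--- : ∀ {a c} → a < 0ℤ → c < 0ℤ → halfTerm a c ≡ - (a * c)
halfTerm--- {a} {c} a<0 c<0 with 0ℤ <? a | 0ℤ <? c
... | yes 0<a | _ = ⊥-elim (<-asym 0<a a<0)
... | no _ | _ with a <? 0ℤ | c <? 0ℤ
...   | yes _ | yes _ = refl
...   | no a≮0 | _ = ⊥-elim (a≮0 a<0)
...   | yes _ | no c≮0 = ⊥-elim (c≮0 c<0)

Signed : ℤ → Set
Signed a = 0ℤ < a ⊎ a < 0ℤ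

halfTerm-antisym : ∀ {a c} → Signed a → Signed c → halfTerm (- c) (- a) ≡ - halfTerm a c
halfTerm-antisym {a} {c} (inj₁ 0<a) (inj₁ 0<c) = begin
  halfTerm (- c) (- a)  ≡⟨ halfTerm--- (neg-mono-< 0<c) (neg-mono-< 0<a) ⟩
  - (- c * - a)         ≡⟨ ring a c ⟩
  - (a * c)             ≡⟨ cong -_ (halfTerm-++ 0<a 0<c) ⟨
  - halfTerm a c        ∎
  where
  open ≡-Reasoning
  ring : ∀ a c → - (- c * - a) ≡ - (a * c)
  ring = solve-∀
halfTerm-antisym {a} {c} (inj₁ 0<a) (inj₂ c<0) =
  trans (halfTerm-+- (neg-mono-< c<0) (neg-mono-< 0<a)) (cong -_ (sym (halfTerm-+- 0<a c<0)))
halfTerm-antisym {a} {c} (inj₂ a<0) (inj₁ 0<c) =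
  trans (halfTerm--+ (neg-mono-< 0<c) (neg-mono-< a<0)) (cong -_ (sym (halfTerm--+ a<0 0<c)))
halfTerm-antisym {a} {c} (inj₂ a<0) (inj₂ c<0) = begin
  halfTerm (- c) (- a)  ≡⟨ halfTerm-++ (neg-mono-< c<0) (neg-mono-< a<0) ⟩
  - c * - a             ≡⟨ ring a c ⟩
  - - (a * c)           ≡⟨ cong -_ (halfTerm--- a<0 c<0) ⟨
  - halfTerm a c        ∎
  where
  open ≡-Reasoning
  ring : ∀ a c → - c * - a ≡ - - (a * c)
  ring = solve-∀

module _ (b : Matrix n) where

  mutB-row : ∀ k v → mutB k b k v ≡ - b k v
  mutB-row k v with k ≟ k | v ≟ k
  ... | yes _ | _ = refl
  ... | no k≢k | _ = ⊥-elim (k≢k refl)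

  mutB-col : ∀ k u → mutB k b u k ≡ - b u k
  mutB-col k u with u ≟ k | k ≟ k
  ... | yes _ | _ = refl
  ... | no _ | yes _ = refl
  ... | no _ | no k≢k = ⊥-elim (k≢k refl)

  mutB-off : u ≢ k → v ≢ k → mutB k b u v ≡ b u v + halfTerm (b u k) (b k v)
  mutB-off {u = u} {k = k} {v = v} u≢k v≢k with u ≟ k | v ≟ k
  ... | yes u≡k | _ = ⊥-elim (u≢k u≡k)
  ... | no _ | yes v≡k = ⊥-elim (v≢k v≡k)
  ... | no _ | no _ = refl

_⟶⟨_⟩_ : Fin n → Matrix n → Fin n → Set
u ⟶⟨ b ⟩ v = 0ℤ < b u v

Skew : Matrix n → Set
Skew b = ∀ u v → b u v ≡ - b v u

Large : Matrix n → Set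
Large b = ∀ u v → u ≢ v → 2 ℕ.≤ ∣ b u v ∣

_≼_ : Matrix n → Matrix n → Set
b ≼ c = ∀ u v → u ≢ v → ∣ b u v ∣ ℕ.≤ ∣ c u v ∣

∣∣-sym : ∀ {b : Matrix n} → Skew b → ∀ u v → ∣ b u v ∣ ≡ ∣ b v u ∣
∣∣-sym {b = b} skew-b u v = trans (cong ∣_∣ (skew-b u v)) (∣-i∣≡∣i∣ (b v u))

record Cycle (b : Matrix n) (x y z : Fin n) : Set where
  constructor cycle
  field
    x⟶y : x ⟶⟨ b ⟩ y
    y⟶z : y ⟶⟨ b ⟩ z
    z⟶x : z ⟶⟨ b ⟩ x

Cycle-≡ : ∀ {b c : Matrix n} → b x y ≡ c x y → b y z ≡ c y z → b z x ≡ c z x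
        → Cycle b x y z → Cycle c x y z
Cycle-≡ p q r (cycle x⟶y y⟶z z⟶x) =
  cycle (subst (0ℤ <_) p x⟶y) (subst (0ℤ <_) q y⟶z) (subst (0ℤ <_) r z⟶x)

PivotAscends : Matrix n → Fin n → Set
PivotAscends b k = ∀ {u v} → Cycle b u k v → Ascent b k u v

InAcyclic : Matrix n → Fin n → Set
InAcyclic b k = ∀ {x y z} → x ⟶⟨ b ⟩ k → y ⟶⟨ b ⟩ k → z ⟶⟨ b ⟩ k → ¬ Cycle b x y z

OutAcyclic : Matrix n → Fin n → Set
OutAcyclic b k = ∀ {x y z} → k ⟶⟨ b ⟩ x → k ⟶⟨ b ⟩ y → k ⟶⟨ b ⟩ z → ¬ Cycle b x y z

record Fork (b : Matrix n) (r : Fin n) : Set where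
  field
    isSkew     : Skew b
    isLarge    : Large b
    inAcyclic  : InAcyclic b r
    outAcyclic : OutAcyclic b r
    shortcut   : u ⟶⟨ b ⟩ r → r ⟶⟨ b ⟩ v → b u r < b v u × b r v < b v u

module ExchangeMatrix {b : Matrix n} (skew-b : Skew b) (large-b : Large b) where

  infix 4 _⟶_
  _⟶_ : Fin n → Fin n → Set
  u ⟶ v = u ⟶⟨ b ⟩ v

  neg-b : ∀ u v → - b u v ≡ b v u
  neg-b u v = trans (cong -_ (skew-b u v)) (neg-involutive (b v u))

  ⟶⇒≢ : u ⟶ v → u ≢ v
  ⟶⇒≢ {u = u} u⟶v refl = <-irrefl (sym (x≡-x⇒x≡0 (skew-b u u))) u⟶v

  ⟵⇒<0 : v ⟶ u → b u v < 0ℤ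
  ⟵⇒<0 {v = v} {u = u} v⟶u = subst (_< 0ℤ) (sym (skew-b u v)) (neg-mono-< v⟶u)

  <0⇒⟵ : b u v < 0ℤ → v ⟶ u
  <0⇒⟵ {u = u} {v = v} b<0 = subst (0ℤ <_) (sym (skew-b v u)) (neg-mono-< b<0)

  ⟶-asym : u ⟶ v → ¬ v ⟶ u
  ⟶-asym u⟶v v⟶u = <-asym u⟶v (⟵⇒<0 v⟶u)

  ⟶-total : u ≢ v → u ⟶ v ⊎ v ⟶ u
  ⟶-total {u = u} {v = v} u≢v with <-cmp 0ℤ (b u v)
  ... | tri< 0<b _ _ = inj₁ 0<b
  ... | tri≈ _ 0≡b _ = ⊥-elim (ℕₚ.<⇒≱ (large-b u v u≢v) (subst (λ t → ∣ t ∣ ℕ.≤ 1) 0≡b z≤n))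
  ... | tri> _ _ b<0 = inj₂ (<0⇒⟵ b<0)

  signed : u ≢ v → Signed (b u v)
  signed u≢v with ⟶-total u≢v
  ... | inj₁ u⟶v = inj₁ u⟶v
  ... | inj₂ v⟶u = inj₂ (⟵⇒<0 v⟶u)

  ⟶⇒+2≤ : u ⟶ v → + 2 ≤ b u v
  ⟶⇒+2≤ {u = u} {v = v} u⟶v = 0<⇒+2≤ u⟶v (large-b u v (⟶⇒≢ u⟶v))

  mutB-skew : ∀ k → Skew (mutB k b)
  mutB-skew k u v with toSum (u ≟ k) | toSum (v ≟ k)
  ... | inj₁ refl | _ = begin
    mutB u b u v    ≡⟨ mutB-row b u v ⟩
    - b u v         ≡⟨ cong -_ (skew-b u v) ⟩
    - - b v u       ≡⟨ cong -_ (mutB-col b u v) ⟨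
    - mutB u b v u  ∎
    where open ≡-Reasoning
  ... | inj₂ _ | inj₁ refl = begin
    mutB v b u v    ≡⟨ mutB-col b v u ⟩
    - b u v         ≡⟨ cong -_ (skew-b u v) ⟩
    - - b v u       ≡⟨ cong -_ (mutB-row b v u) ⟨
    - mutB v b v u  ∎
    where open ≡-Reasoning
  ... | inj₂ u≢k | inj₂ v≢k = begin
    mutB k b u v                         ≡⟨ mutB-off b u≢k v≢k ⟩
    b u v + halfTerm (b u k) (b k v)     ≡⟨ cong₂ _+_ (skew-b u v) (cong₂ halfTerm (skew-b u k) (skew-b k v)) ⟩
    - b v u + halfTerm (- b k u) (- b v k)
      ≡⟨ cong (_+_ (- b v u)) (halfTerm-antisym (signed v≢k) (signed (≢-sym u≢k))) ⟩
    - b v u + - halfTerm (b v k) (b k u) ≡⟨ neg-distrib-+ (b v u) _ ⟨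
    - (b v u + halfTerm (b v k) (b k u)) ≡⟨ cong -_ (mutB-off b v≢k u≢k) ⟨
    - mutB k b v u                       ∎
    where open ≡-Reasoning

  mutB-path : u ⟶ k → k ⟶ v → mutB k b u v ≡ b u v + b u k * b k v
  mutB-path {u = u} {v = v} u⟶k k⟶v =
    trans (mutB-off b (⟶⇒≢ u⟶k) (≢-sym (⟶⇒≢ k⟶v))) (cong (_+_ (b u v)) (halfTerm-++ u⟶k k⟶v))

  mutB-outs : k ⟶ u → k ⟶ v → mutB k b u v ≡ b u v
  mutB-outs {u = u} {v = v} k⟶u k⟶v =
    trans (mutB-off b (≢-sym (⟶⇒≢ k⟶u)) (≢-sym (⟶⇒≢ k⟶v)))
          (trans (cong (_+_ (b u v)) (halfTerm--+ (⟵⇒<0 k⟶u) k⟶v)) (+-identityʳ (b u v)))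

  mutB-ins : u ⟶ k → v ⟶ k → mutB k b u v ≡ b u v
  mutB-ins {u = u} {v = v} u⟶k v⟶k =
    trans (mutB-off b (⟶⇒≢ u⟶k) (⟶⇒≢ v⟶k))
          (trans (cong (_+_ (b u v)) (halfTerm-+- u⟶k (⟵⇒<0 v⟶k))) (+-identityʳ (b u v)))

  mutB-reverses-in : u ⟶⟨ mutB k b ⟩ k → k ⟶ u
  mutB-reverses-in {u = u} {k = k} u⟶′k = subst (0ℤ <_) (neg-b u k) (subst (0ℤ <_) (mutB-col b k u) u⟶′k)

  mutB-reverses-out : k ⟶⟨ mutB k b ⟩ v → v ⟶ k
  mutB-reverses-out {k = k} {v = v} k⟶′v = subst (0ℤ <_) (neg-b k v) (subst (0ℤ <_) (mutB-row b k v) k⟶′v)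

  path-ascends : PivotAscends b k → u ⟶ k → k ⟶ v → Ascent b k u v
  path-ascends {u = u} {v = v} ascends u⟶k k⟶v with ⟶-total u≢v
    where
    u≢v : u ≢ v
    u≢v refl = ⟶-asym u⟶k k⟶v
  ... | inj₁ u⟶v = subst (λ t → ∣ b u v ∣ ℕ.< ∣ t ∣) (sym (mutB-path u⟶k k⟶v)) (∣z∣<∣z+p∣ u⟶v (0<* u⟶k k⟶v))
  ... | inj₂ v⟶u = ascends (cycle u⟶k k⟶v v⟶u)

  ≼-mutB : PivotAscends b k → b ≼ mutB k b
  ≼-mutB {k = k} ascends u v u≢v with toSum (u ≟ k) | toSum (v ≟ k)
  ... | inj₁ refl | _ = ℕₚ.≤-reflexive (sym (trans (cong ∣_∣ (mutB-row b u v)) (∣-i∣≡∣i∣ (b u v))))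
  ... | inj₂ _ | inj₁ refl = ℕₚ.≤-reflexive (sym (trans (cong ∣_∣ (mutB-col b v u)) (∣-i∣≡∣i∣ (b u v))))
  ... | inj₂ u≢k | inj₂ v≢k with ⟶-total u≢k | ⟶-total (≢-sym v≢k)
  ...   | inj₁ u⟶k | inj₁ k⟶v = ℕₚ.<⇒≤ (path-ascends ascends u⟶k k⟶v)
  ...   | inj₂ k⟶u | inj₂ v⟶k =
    subst₂ ℕ._≤_ (∣∣-sym skew-b v u) (∣∣-sym (mutB-skew k) v u) (ℕₚ.<⇒≤ (path-ascends ascends v⟶k k⟶u))
  ...   | inj₁ u⟶k | inj₂ v⟶k = ℕₚ.≤-reflexive (cong ∣_∣ (sym (mutB-ins u⟶k v⟶k)))
  ...   | inj₂ k⟶u | inj₁ k⟶v = ℕₚ.≤-reflexive (cong ∣_∣ (sym (mutB-outs k⟶u k⟶v)))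

  mutB-fork : PivotAscends b k → InAcyclic b k → OutAcyclic b k → Fork (mutB k b) k
  mutB-fork {k = k} ascends in-acyclic out-acyclic = record
    { isSkew     = mutB-skew k
    ; isLarge    = λ u v u≢v → ℕₚ.≤-trans (large-b u v u≢v) (≼-mutB ascends u v u≢v)
    ; inAcyclic  = λ x⟶′k y⟶′k z⟶′k →
        let k⟶x = mutB-reverses-in x⟶′k ; k⟶y = mutB-reverses-in y⟶′k ; k⟶z = mutB-reverses-in z⟶′k in
        λ c → out-acyclic k⟶x k⟶y k⟶z
                (Cycle-≡ (mutB-outs k⟶x k⟶y) (mutB-outs k⟶y k⟶z) (mutB-outs k⟶z k⟶x) c)
    ; outAcyclic = λ k⟶′x k⟶′y k⟶′z →
        let x⟶k = mutB-reverses-out k⟶′x ; y⟶k = mutB-reverses-out k⟶′y ; z⟶k = mutB-reverses-out k⟶′z in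
        λ c → in-acyclic x⟶k y⟶k z⟶k
                (Cycle-≡ (mutB-ins x⟶k y⟶k) (mutB-ins y⟶k z⟶k) (mutB-ins z⟶k x⟶k) c)
    ; shortcut   = shortcut
    }
    where
    b′ = mutB k b
    shortcut : u ⟶⟨ b′ ⟩ k → k ⟶⟨ b′ ⟩ v → b′ u k < b′ v u × b′ k v < b′ v u
    shortcut {u = u} {v = v} u⟶′k k⟶′v =
      subst₂ (λ s t → s < b′ v u × t < b′ v u)
        (sym (trans (mutB-col b k u) (neg-b u k))) (sym (trans (mutB-row b k v) (neg-b k v)))
        (ascent⇒factors< {z = b v u} (⟶⇒+2≤ k⟶u) (⟶⇒+2≤ v⟶k) (mutB-path v⟶k k⟶u) (path-ascends ascends v⟶k k⟶u))
      where
      k⟶u = mutB-reverses-in u⟶′k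
      v⟶k = mutB-reverses-out k⟶′v

-- Forks are preserved by mutation away from their centre

module ForkProperties {b : Matrix n} {r : Fin n} (fork : Fork b r) where

  open Fork fork
  open ExchangeMatrix isSkew isLarge

  path⇒⟵ : u ⟶ r → r ⟶ v → v ⟶ u
  path⇒⟵ u⟶r r⟶v = <-trans u⟶r (proj₁ (shortcut u⟶r r⟶v))

  cycle-avoiding : x ≢ r → y ≢ r → z ≢ r → ¬ Cycle b x y z
  cycle-avoiding x≢r y≢r z≢r c@(cycle x⟶y y⟶z z⟶x) with ⟶-total x≢r | ⟶-total y≢r | ⟶-total z≢r
  ... | inj₁ x⟶r | inj₁ y⟶r | inj₁ z⟶r = inAcyclic x⟶r y⟶r z⟶r c
  ... | inj₂ r⟶x | inj₂ r⟶y | inj₂ r⟶z = outAcyclic r⟶x r⟶y r⟶z c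
  ... | inj₁ x⟶r | inj₂ r⟶y | _        = ⟶-asym x⟶y (path⇒⟵ x⟶r r⟶y)
  ... | _        | inj₁ y⟶r | inj₂ r⟶z = ⟶-asym y⟶z (path⇒⟵ y⟶r r⟶z)
  ... | inj₂ r⟶x | _        | inj₁ z⟶r = ⟶-asym z⟶x (path⇒⟵ z⟶r r⟶x)

  cycle-through : Cycle b x y z → x ≡ r ⊎ y ≡ r ⊎ z ≡ r
  cycle-through {x = x} {y = y} {z = z} c with x ≟ r | y ≟ r | z ≟ r
  ... | yes x≡r | _ | _ = inj₁ x≡r
  ... | no _ | yes y≡r | _ = inj₂ (inj₁ y≡r)
  ... | no _ | no _ | yes z≡r = inj₂ (inj₂ z≡r)
  ... | no x≢r | no y≢r | no z≢r = ⊥-elim (cycle-avoiding x≢r y≢r z≢r c)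

  inAcyclic-everywhere : ∀ k → InAcyclic b k
  inAcyclic-everywhere k x⟶k y⟶k z⟶k c@(cycle x⟶y y⟶z z⟶x) with cycle-through c
  ... | inj₁ refl        = ⟶-asym z⟶k (path⇒⟵ z⟶x x⟶k)
  ... | inj₂ (inj₁ refl) = ⟶-asym x⟶k (path⇒⟵ x⟶y y⟶k)
  ... | inj₂ (inj₂ refl) = ⟶-asym y⟶k (path⇒⟵ y⟶z z⟶k)

  outAcyclic-everywhere : ∀ k → OutAcyclic b k
  outAcyclic-everywhere k k⟶x k⟶y k⟶z c@(cycle x⟶y y⟶z z⟶x) with cycle-through c
  ... | inj₁ refl        = ⟶-asym k⟶y (path⇒⟵ k⟶x x⟶y)
  ... | inj₂ (inj₁ refl) = ⟶-asym k⟶z (path⇒⟵ k⟶y y⟶z)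
  ... | inj₂ (inj₂ refl) = ⟶-asym k⟶x (path⇒⟵ k⟶z z⟶x)

  pivotAscends : k ≢ r → PivotAscends b k
  pivotAscends {k = k} k≢r {u} {v} c@(cycle u⟶k k⟶v v⟶u) with cycle-through c
  ... | inj₂ (inj₁ k≡r) = ⊥-elim (k≢r k≡r)
  ... | inj₁ refl =
    cycle-ascent v⟶u (proj₁ (shortcut v⟶u u⟶k)) (⟶⇒+2≤ u⟶k)
      (isSkew _ _) (mutB-path u⟶k k⟶v)
  ... | inj₂ (inj₂ refl) =
    cycle-ascent v⟶u (proj₂ (shortcut k⟶v v⟶u)) (⟶⇒+2≤ k⟶v)
      (isSkew _ _) (trans (mutB-path u⟶k k⟶v) (cong (_+_ (b u v)) (*-comm (b u k) (b k v))))

  mutB-preserves-fork : k ≢ r → Fork (mutB k b) k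
  mutB-preserves-fork {k = k} k≢r =
    mutB-fork (pivotAscends k≢r) (inAcyclic-everywhere k) (outAcyclic-everywhere k)

  ≼-mutB-away : k ≢ r → b ≼ mutB k b
  ≼-mutB-away k≢r = ≼-mutB (pivotAscends k≢r)

≼-mutSeq : ∀ {b : Matrix n} {ks} → Fork b r → Chain (r ∷ ks) → b ≼ mutSeq ks b
≼-mutSeq {ks = []} _ _ _ _ _ = ℕₚ.≤-refl
≼-mutSeq {ks = k ∷ ks} fork (r≢k ∷ chain) u v u≢v =
  ℕₚ.≤-trans (≼-mutB-away (≢-sym r≢k) u v u≢v)
             (≼-mutSeq (mutB-preserves-fork (≢-sym r≢k)) chain u v u≢v)
  where open ForkProperties fork

module Hypotheses {b : Matrix n} (skew-b : Skew b) (large-b : Large b) (i : Fin n) where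

  open ExchangeMatrix skew-b large-b

  ascents⇒pivotAscends : (∀ j k → i ≢ j → i ≢ k → j ≢ k → Cyclic3 b i j k → Ascent b i j k)
                       → PivotAscends b i
  ascents⇒pivotAscends ascents (cycle u⟶i i⟶v v⟶u) =
    ascents _ _ (≢-sym (⟶⇒≢ u⟶i)) (⟶⇒≢ i⟶v) (≢-sym (⟶⇒≢ v⟶u)) (inj₂ (u⟶i , v⟶u , i⟶v))

  linked : u ⟶ v ⊎ v ⟶ u → u ≢ v × b u v ≢ 0ℤ
  linked (inj₁ u⟶v) = ⟶⇒≢ u⟶v , ≢-sym (<⇒≢ u⟶v)
  linked (inj₂ v⟶u) = ≢-sym (⟶⇒≢ v⟶u) , <⇒≢ (⟵⇒<0 v⟶u)

  vortex : Cycle b x y z → i ⟶ x ⊎ x ⟶ i → i ⟶ y ⊎ y ⟶ i → i ⟶ z ⊎ z ⟶ i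
         → (x ⇢⟨ b ⟩ i × y ⇢⟨ b ⟩ i × z ⇢⟨ b ⟩ i) ⊎ (i ⇢⟨ b ⟩ x × i ⇢⟨ b ⟩ y × i ⇢⟨ b ⟩ z)
         → IsApexOfVortex b i
  vortex {x = x} {y = y} {z = z} (cycle x⟶y y⟶z z⟶x) ix iy iz sink⊎source =
    let (i≢x , bix≢0) = linked ix
        (i≢y , biy≢0) = linked iy
        (i≢z , biz≢0) = linked iz
        (x≢y , bxy≢0) = linked (inj₁ x⟶y)
        (x≢z , bxz≢0) = linked (inj₂ z⟶x)
        (y≢z , byz≢0) = linked (inj₁ y⟶z)
    in x , y , z
       , (i≢x , i≢y , i≢z , x≢y , x≢z , y≢z)
       , (bix≢0 , biy≢0 , biz≢0 , bxy≢0 , bxz≢0 , byz≢0)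
       , sink⊎source
       , inj₁ (x⟶y , y⟶z , z⟶x)

  ¬apex⇒inAcyclic : ¬ IsApexOfVortex b i → InAcyclic b i
  ¬apex⇒inAcyclic ¬apex x⟶i y⟶i z⟶i c =
    ¬apex (vortex c (inj₂ x⟶i) (inj₂ y⟶i) (inj₂ z⟶i) (inj₁ (<⇒≤ x⟶i , <⇒≤ y⟶i , <⇒≤ z⟶i)))

  ¬apex⇒outAcyclic : ¬ IsApexOfVortex b i → OutAcyclic b i
  ¬apex⇒outAcyclic ¬apex i⟶x i⟶y i⟶z c =
    ¬apex (vortex c (inj₁ i⟶x) (inj₁ i⟶y) (inj₁ i⟶z) (inj₂ (<⇒≤ i⟶x , <⇒≤ i⟶y , <⇒≤ i⟶z)))

  some-negative : (f : Fin n → ℤ) → ¬ (∀ v → v ≢ i → 0ℤ ≤ f v) → ∃[ v ] f v < 0ℤ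
  some-negative f ¬all with ¬∀⟶∃¬ n _ (λ v → ¬? (v ≟ i) →-dec (0ℤ ≤? f v)) ¬all
  ... | v , ¬nonneg = v , ≰⇒> (λ 0≤f → ¬nonneg (λ _ → 0≤f))

  ¬sink⇒out : ¬ IsSink b i → ∃[ v ] i ⟶ v
  ¬sink⇒out ¬sink with some-negative (λ v → b v i) ¬sink
  ... | v , b<0 = v , <0⇒⟵ b<0

  ¬source⇒in : ¬ IsSource b i → ∃[ w ] w ⟶ i
  ¬source⇒in ¬source with some-negative (b i) ¬source
  ... | w , b<0 = w , <0⇒⟵ b<0

  ¬sink⊎source⇒ascent : PivotAscends b i → ¬ (IsSink b i ⊎ IsSource b i)
                      → ∃[ u ] ∃[ v ] u ≢ v × Ascent b i u v
  ¬sink⊎source⇒ascent ascends ¬sink⊎source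
    with ¬source⇒in (λ source → ¬sink⊎source (inj₂ source))
       | ¬sink⇒out (λ sink → ¬sink⊎source (inj₁ sink))
  ... | u , u⟶i | v , i⟶v = u , v , u≢v , path-ascends ascends u⟶i i⟶v
    where
    u≢v : u ≢ v
    u≢v refl = ⟶-asym u⟶i i⟶v

fork-exit : (Q : Quiver n) (i : Fin n) → Fork (mutB i (B Q)) i
          → ∃[ u ] ∃[ v ] u ≢ v × Ascent (B Q) i u v → IsExit Q i
fork-exit Q i fork (u , v , u≢v , ascent) ks chain Q≈μQ = ℕₚ.<⇒≱ ascent (begin
  ∣ mutB i (B Q) u v ∣          ≤⟨ ≼-mutSeq fork chain u v u≢v ⟩
  ∣ mutSeq (i ∷ ks) (B Q) u v ∣ ≡⟨ cong ∣_∣ (Q≈μQ u v) ⟨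
  ∣ B Q u v ∣                   ∎)
  where open ℕₚ.≤-Reasoning

proposition6p13 : ∀ {n : ℕ} (Q : Quiver n) (i : Fin n)
    → LargeWeights Q
    → (∀ j k → i ≢ j → i ≢ k → j ≢ k → Cyclic3 (B Q) i j k → Ascent (B Q) i j k)
    → ¬ (IsSink (B Q) i ⊎ IsSource (B Q) i)
    → ¬ IsApexOfVortex (B Q) i
    → IsExit Q i
proposition6p13 Q i large ascents ¬sink⊎source ¬apex =
  fork-exit Q i (mutB-fork ascends (¬apex⇒inAcyclic ¬apex) (¬apex⇒outAcyclic ¬apex))
                (¬sink⊎source⇒ascent ascends ¬sink⊎source)
  where
  open ExchangeMatrix (skew Q) large
  open Hypotheses (skew Q) large i
  ascends = ascents⇒pivotAscends ascents
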